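{- Let $n,s$ be positive integers with $n \geq 2$. If either (1) $1 \leq s < \frac{n}{2}$, or (2) $\gcd(s,n)=1$ and $\frac{n}{2} \leq s < n-1$, then there exists an $s$-overlap cycle on the set of all permutations of $[n]=\{1,2,\ldots,n\}$, each permutation being written as a string of length $n$.
   Context: For a finite set $\mathcal{C}$ of strings, each of length $n$, and an integer $1 \le s < n$, an $s$-overlap cycle ($s$-ocycle) on $\mathcal{C}$ is a cyclic ordering $c^{(1)}, c^{(2)}, \ldots, c^{(N)}$ of all elements of $\mathcal{C}$, each appearing exactly once, such that for every $j$ (indices taken cyclically, so $c^{(N)}$ is followed by $c^{(1)}$), the last $s$ letters of $c^{(j)}$ equal the first $s$ letters of $c^{(j+1)}$; that is, if $a=a_1\ldots a_n$ is followed by $b=b_1\ldots b_n$ then $a_{n-s+1}a_{n-s+2}\ldots a_n = b_1 b_2\ldots b_s$. -}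

module Defs where

open import Data.Nat using (ℕ; suc; _∸_)
open import Data.List using (List; []; _∷_; _++_; [_]; map; upTo; take; drop; length)
open import Data.List.Relation.Unary.All using (All)
open import Data.List.Relation.Unary.Unique.Propositional using (Unique)
open import Data.List.Membership.Propositional using (_∈_)
open import Data.List.Relation.Binary.Permutation.Propositional using (_↭_)
open import Relation.Binary.PropositionalEquality using (_≡_)
open import Data.Product using (_×_)

Word : Set
Word = List ℕ

[1‥_] : ℕ → List ℕ
[1‥ n ] = map suc (upTo n)

IsPermWord : ℕ → Word → Set
IsPermWord n w = w ↭ [1‥ n ]

-- a = a₁…aₙ followed by b = b₁…bₙ with overlap s:
-- the last s letters of a equal the first s letters of b
Overlaps : ℕ → ℕ → Word → Word → Set
Overlaps n s a b = drop (n ∸ s) a ≡ take s b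

data Chain (R : Word → Word → Set) : List Word → Set where
  chain-[]  : Chain R []
  chain-[-] : ∀ {x} → Chain R (x ∷ [])
  chain-∷   : ∀ {x y xs} → R x y → Chain R (y ∷ xs) → Chain R (x ∷ y ∷ xs)

CyclicChain : (Word → Word → Set) → List Word → Set
CyclicChain R []       = Chain R []
CyclicChain R (x ∷ xs) = Chain R (x ∷ xs ++ [ x ])

IsOCycle : (n s : ℕ) → (C : Word → Set) → List Word → Set
IsOCycle n s C L =
  All (λ w → length w ≡ n) L ×
  Unique L ×
  (∀ w → C w → w ∈ L) ×
  All C L ×
  CyclicChain (Overlaps n s) L

module Submission where

-- Put k = n ∸ s and let R rotate a word left by k letters.  For a word w of
-- length n the last s letters of w are the first s letters of R w, so every
-- R-orbit, listed in order, is already an s-overlap cycle, and R preserves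
-- permutations.  Two cycles can be joined: if q lies outside an R-closed
-- cycle B but shares its first s letters with some p ∈ B, the orbit of q is
-- spliced into B just before p.  Starting from the orbit of 1 2 … n we splice
-- until no swap of two adjacent positions i, i+1 with i ≥ s (which keeps the
-- first s letters) leads outside B; this terminates because B grows inside
-- the finite set of words of length n over [n].  The resulting B is closed
-- under R and under these "tail swaps", and in either case of the theorem
-- this forces closure under all adjacent transpositions: if 2s < n a rotation
-- by s letters moves any adjacent pair into the tail, and if gcd(s,n) = 1 the
-- rotation by one letter is a power of R, so any pair can be rotated to the
-- end.  Hence B contains every permutation and is the required s-ocycle.

open import Defs
open import Data.Nat using (ℕ; zero; suc; _+_; _*_; _∸_; _≤_; _<_; z≤n; s≤s; s≤s⁻¹; _≤?_; _<?_; _≟_)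
open import Data.Nat.Properties
open import Data.Nat.GCD using (gcd; module Bézout)
open import Data.Nat.Coprimality using (gcd≡1⇒coprime; coprime-Bézout)
open import Data.Nat.GeneralisedArithmetic using (iterate)
open import Data.Nat.Tactic.RingSolver using (solve-∀)
open import Data.List as List using (List; []; _∷_; _++_; [_]; map; take; drop; length; upTo; cartesianProductWith)
open import Data.List.Properties using (length-++; length-++-≤ˡ; length-map; length-upTo; length-drop; take++drop≡id; take-all; drop-all; ++-assoc; ++-identityʳ; ≡-dec)
open import Data.List.Relation.Unary.All as All using (All; []; _∷_)
open import Data.List.Relation.Unary.Any as Any using (here; there)
open import Data.List.Relation.Unary.AllPairs using ([]; _∷_)
open import Data.List.Relation.Unary.Unique.Propositional using (Unique)
import Data.List.Relation.Unary.Unique.Propositional.Properties as Unique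
open import Data.List.Membership.Propositional using (_∈_; _∉_; find; lose)
open import Data.List.Membership.Propositional.Properties using (∈-++⁺ˡ; ∈-++⁺ʳ; ∈-++⁻; ∈-∃++; ∈-upTo⁺; ∈-cartesianProductWith⁺)
open import Data.List.Relation.Binary.Permutation.Propositional as Perm using (_↭_; ↭-sym; ↭-reflexive; ↭-trans)
open import Data.List.Relation.Binary.Permutation.Propositional.Properties using (↭-length; ∈-resp-↭; ++-comm)
open import Data.Product using (Σ; ∃₂; _×_; _,_; uncurry)
open import Data.Sum as Sum using (_⊎_; inj₁; inj₂; [_,_]′)
open import Data.Empty using (⊥-elim)
open import Function using (_∘_)
open import Relation.Nullary using (¬_; Dec; yes; no; ¬?)
open import Relation.Nullary.Decidable using (_×-dec_)
open import Relation.Binary.Definitions using (DecidableEquality)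
open import Relation.Binary.PropositionalEquality using (_≡_; _≢_; refl; sym; trans; cong; cong₂; subst; module ≡-Reasoning)
open ≡-Reasoning

least : (P : ℕ → Set) → (∀ i → Dec (P i)) → ∀ N → P N → Σ ℕ λ m → P m × (∀ i → i < m → ¬ P i)
least P P? N pN with P? 0
... | yes p0 = 0 , p0 , λ _ ()
least P P? zero    p0 | no ¬p0 = ⊥-elim (¬p0 p0)
least P P? (suc N) pN | no ¬p0 with least (P ∘ suc) (P? ∘ suc) N pN
... | m , pm , below = suc m , pm , λ where
  zero    _       → ¬p0
  (suc i) 1+i<1+m → below i (s≤s⁻¹ 1+i<1+m)

module _ {A : Set} (f : A → A) where

  iterate-+ : ∀ x a b → iterate f x (a + b) ≡ iterate f (iterate f x a) b
  iterate-+ x zero    b = refl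
  iterate-+ x (suc a) b = iterate-+ (f x) a b

  iterate-suc : ∀ x i → iterate f x (suc i) ≡ f (iterate f x i)
  iterate-suc x zero    = refl
  iterate-suc x (suc i) = iterate-suc (f x) i

  iterate-period : ∀ x p → iterate f x p ≡ x → ∀ c → iterate f x (c * p) ≡ x
  iterate-period x p ret zero    = refl
  iterate-period x p ret (suc c) = begin
    iterate f x (p + c * p)           ≡⟨ iterate-+ x p (c * p) ⟩
    iterate f (iterate f x p) (c * p) ≡⟨ cong (λ y → iterate f y (c * p)) ret ⟩
    iterate f x (c * p)               ≡⟨ iterate-period x p ret c ⟩
    x                                 ∎

  iterate-preserves : {P : A → Set} → (∀ {x} → P x → P (f x)) → ∀ {x} i → P x → P (iterate f x i)
  iterate-preserves     pres zero    px = px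
  iterate-preserves {P} pres (suc i) px = iterate-preserves {P} pres i (pres px)

  ∈-trajectory⁻ : ∀ {y} x p → y ∈ List.iterate f x p → Σ ℕ λ i → i < p × y ≡ iterate f x i
  ∈-trajectory⁻ x (suc p) (here y≡x) = 0 , s≤s z≤n , y≡x
  ∈-trajectory⁻ x (suc p) (there y∈) with ∈-trajectory⁻ (f x) p y∈
  ... | i , i<p , y≡ = suc i , s≤s i<p , y≡

  ∈-trajectory⁺ : ∀ x p i → i < p → iterate f x i ∈ List.iterate f x p
  ∈-trajectory⁺ x (suc p) zero    _         = here refl
  ∈-trajectory⁺ x (suc p) (suc i) (s≤s i<p) = there (∈-trajectory⁺ (f x) p i i<p)

  trajectory-shift : ∀ x p → List.iterate f (f x) p ≡ map f (List.iterate f x p)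
  trajectory-shift x zero    = refl
  trajectory-shift x (suc p) = cong (f x ∷_) (trajectory-shift (f x) p)

  trajectory-unique : (∀ {y z} → f y ≡ f z → y ≡ z) → ∀ x p →
                      (∀ i → 0 < i → i < p → iterate f x i ≢ x) → Unique (List.iterate f x p)
  trajectory-unique inj x zero    _         = []
  trajectory-unique inj x (suc p) no-return =
    All.tabulate x-not-later ∷
    subst Unique (sym (trajectory-shift x p))
      (Unique.map⁺ inj (trajectory-unique inj x p (λ i 0<i i<p → no-return i 0<i (m<n⇒m<1+n i<p))))
    where
    x-not-later : ∀ {y} → y ∈ List.iterate f (f x) p → x ≢ y
    x-not-later y∈ x≡y with ∈-trajectory⁻ (f x) p y∈
    ... | i , i<p , y≡ = no-return (suc i) (s≤s z≤n) (s≤s i<p) (sym (trans x≡y y≡))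

  trajectory-closed : ∀ x p → iterate f x p ≡ x → ∀ {y} → y ∈ List.iterate f x p → f y ∈ List.iterate f x p
  trajectory-closed x p ret y∈ with ∈-trajectory⁻ x p y∈
  ... | i , i<p , refl with m≤n⇒m<n∨m≡n i<p
  ...   | inj₁ 1+i<p = subst (_∈ List.iterate f x p) (iterate-suc x i) (∈-trajectory⁺ x p (suc i) 1+i<p)
  ...   | inj₂ 1+i≡p = subst (_∈ List.iterate f x p) x≡f[fⁱx] (∈-trajectory⁺ x p 0 (≤-trans (s≤s z≤n) i<p))
    where
    x≡f[fⁱx] : x ≡ f (iterate f x i)
    x≡f[fⁱx] = trans (sym ret) (trans (cong (iterate f x) (sym 1+i≡p)) (iterate-suc x i))

  trajectory-returns : ∀ x p → iterate f x p ≡ x → ∀ {y} → y ∈ List.iterate f x p → Σ ℕ λ j → iterate f y j ≡ x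
  trajectory-returns x p ret y∈ with ∈-trajectory⁻ x p y∈
  ... | i , i<p , refl = p ∸ i , (begin
    iterate f (iterate f x i) (p ∸ i) ≡⟨ iterate-+ x i (p ∸ i) ⟨
    iterate f x (i + (p ∸ i))         ≡⟨ cong (iterate f x) (m+[n∸m]≡n (<⇒≤ i<p)) ⟩
    iterate f x p                     ≡⟨ ret ⟩
    x                                 ∎)

module _ {A : Set} where

  take-++ˡ : ∀ j (xs ys : List A) → j ≤ length xs → take j (xs ++ ys) ≡ take j xs
  take-++ˡ zero    xs       ys _         = refl
  take-++ˡ (suc j) (x ∷ xs) ys (s≤s j≤) = cong (x ∷_) (take-++ˡ j xs ys j≤)

  drop-++ˡ : ∀ j (xs ys : List A) → j ≤ length xs → drop j (xs ++ ys) ≡ drop j xs ++ ys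
  drop-++ˡ zero    xs       ys _         = refl
  drop-++ˡ (suc j) (x ∷ xs) ys (s≤s j≤) = drop-++ˡ j xs ys j≤

  take-length-++ : ∀ (xs ys : List A) → take (length xs) (xs ++ ys) ≡ xs
  take-length-++ []       ys = refl
  take-length-++ (x ∷ xs) ys = cong (x ∷_) (take-length-++ xs ys)

  drop-length-++ : ∀ (xs ys : List A) → drop (length xs) (xs ++ ys) ≡ ys
  drop-length-++ []       ys = refl
  drop-length-++ (x ∷ xs) ys = drop-length-++ xs ys

  length-middle : ∀ (xs : List A) x y ys → length (xs ++ x ∷ y ∷ ys) ≡ suc (suc (length xs + length ys))
  length-middle []       x y ys = refl
  length-middle (z ∷ xs) x y ys = cong suc (length-middle xs x y ys)

  rotL : ℕ → List A → List A
  rotL j w = drop j w ++ take j w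

  rotL-++ : ∀ (xs ys : List A) → rotL (length xs) (xs ++ ys) ≡ ys ++ xs
  rotL-++ xs ys = cong₂ _++_ (drop-length-++ xs ys) (take-length-++ xs ys)

  rotL-↭ : ∀ j (w : List A) → rotL j w ↭ w
  rotL-↭ j w = ↭-trans (++-comm (drop j w) (take j w)) (↭-reflexive (take++drop≡id j w))

  length-rotL : ∀ j (w : List A) → length (rotL j w) ≡ length w
  length-rotL j w = ↭-length (rotL-↭ j w)

  rotL-cancel : ∀ j (w : List A) → rotL (length w ∸ j) (rotL j w) ≡ w
  rotL-cancel j w with j ≤? length w
  ... | yes j≤∣w∣ = begin
    rotL (length w ∸ j) (drop j w ++ take j w)
      ≡⟨ cong (λ i → rotL i (drop j w ++ take j w)) (length-drop j w) ⟨
    rotL (length (drop j w)) (drop j w ++ take j w)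
      ≡⟨ rotL-++ (drop j w) (take j w) ⟩
    take j w ++ drop j w
      ≡⟨ take++drop≡id j w ⟩
    w ∎
  ... | no j≰∣w∣ = begin
    rotL (length w ∸ j) (drop j w ++ take j w)
      ≡⟨ cong₂ rotL (m≤n⇒m∸n≡0 ∣w∣≤j) (cong₂ _++_ (drop-all j w ∣w∣≤j) (take-all j w ∣w∣≤j)) ⟩
    w ++ []
      ≡⟨ ++-identityʳ w ⟩
    w ∎
    where
    ∣w∣≤j : length w ≤ j
    ∣w∣≤j = <⇒≤ (≰⇒> j≰∣w∣)

  rotL-injective : ∀ j {x y : List A} → rotL j x ≡ rotL j y → x ≡ y
  rotL-injective j {x} {y} rx≡ry = begin
    x                              ≡⟨ rotL-cancel j x ⟨
    rotL (length x ∸ j) (rotL j x) ≡⟨ cong₂ (λ l z → rotL (l ∸ j) z) ∣x∣≡∣y∣ rx≡ry ⟩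
    rotL (length y ∸ j) (rotL j y) ≡⟨ rotL-cancel j y ⟩
    y                              ∎
    where
    ∣x∣≡∣y∣ : length x ≡ length y
    ∣x∣≡∣y∣ = trans (sym (length-rotL j x)) (trans (cong length rx≡ry) (length-rotL j y))

  ρ : List A → List A
  ρ = rotL 1

  iterate-ρ : ∀ j (w : List A) → j ≤ length w → iterate ρ w j ≡ rotL j w
  iterate-ρ zero    w       _         = sym (++-identityʳ w)
  iterate-ρ (suc j) (x ∷ w) (s≤s j≤∣w∣) = begin
    iterate ρ (w ++ [ x ]) j
      ≡⟨ iterate-ρ j (w ++ [ x ]) j≤∣w++x∣ ⟩
    drop j (w ++ [ x ]) ++ take j (w ++ [ x ])
      ≡⟨ cong₂ _++_ (drop-++ˡ j w [ x ] j≤∣w∣) (take-++ˡ j w [ x ] j≤∣w∣) ⟩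
    (drop j w ++ [ x ]) ++ take j w
      ≡⟨ ++-assoc (drop j w) [ x ] (take j w) ⟩
    drop j w ++ x ∷ take j w ∎
    where
    j≤∣w++x∣ : j ≤ length (w ++ [ x ])
    j≤∣w++x∣ = ≤-trans j≤∣w∣ (≤-trans (m≤m+n (length w) 1) (≤-reflexive (sym (length-++ w))))

  ρ-periodic : ∀ {m} c (w : List A) → length w ≡ m → iterate ρ w (c * m) ≡ w
  ρ-periodic c w refl = iterate-period ρ w (length w) full-turn c
    where
    full-turn : iterate ρ w (length w) ≡ w
    full-turn = trans (iterate-ρ (length w) w ≤-refl)
                      (cong₂ _++_ (drop-all (length w) w ≤-refl) (take-all (length w) w ≤-refl))

  swapAt : ℕ → List A → List A
  swapAt zero    (x ∷ y ∷ ys) = y ∷ x ∷ ys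
  swapAt (suc i) (x ∷ xs)     = x ∷ swapAt i xs
  swapAt _       xs           = xs

  swapAt-↭ : ∀ i (w : List A) → swapAt i w ↭ w
  swapAt-↭ zero    (x ∷ y ∷ ys) = Perm.swap y x Perm.refl
  swapAt-↭ zero    []           = Perm.refl
  swapAt-↭ zero    (x ∷ [])     = Perm.refl
  swapAt-↭ (suc i) (x ∷ xs)     = Perm.prep x (swapAt-↭ i xs)
  swapAt-↭ (suc i) []           = Perm.refl

  swapAt-take : ∀ j i (w : List A) → j ≤ i → take j (swapAt i w) ≡ take j w
  swapAt-take zero    i       w        _        = refl
  swapAt-take (suc j) (suc i) (x ∷ xs) (s≤s j≤) = cong (x ∷_) (swapAt-take j i xs j≤)
  swapAt-take (suc j) (suc i) []       _        = refl

  swapAt-middle : ∀ (xs : List A) x y ys → swapAt (length xs) (xs ++ x ∷ y ∷ ys) ≡ xs ++ y ∷ x ∷ ys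
  swapAt-middle []       x y ys = refl
  swapAt-middle (z ∷ xs) x y ys = cong (z ∷_) (swapAt-middle xs x y ys)

  adjacent-swaps-generate : (S : List A → Set) →
                            (∀ xs x y ys → S (xs ++ x ∷ y ∷ ys) → S (xs ++ y ∷ x ∷ ys)) →
                            ∀ {w u} → w ↭ u → S w → S u
  adjacent-swaps-generate S swap = behind []
    where
    shift : ∀ pre (xs w : List A) → pre ++ xs ++ w ≡ (pre ++ xs) ++ w
    shift pre xs w = sym (++-assoc pre xs w)

    behind : ∀ pre {w u} → w ↭ u → S (pre ++ w) → S (pre ++ u)
    behind pre Perm.refl                      s = s
    behind pre {x ∷ w} {.x ∷ u} (Perm.prep .x w↭u) s =
      subst S (sym (shift pre [ x ] u)) (behind (pre ++ [ x ]) w↭u (subst S (shift pre [ x ] w) s))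
    behind pre {x ∷ y ∷ w} {.y ∷ .x ∷ u} (Perm.swap .x .y w↭u) s =
      subst S (sym (shift pre (y ∷ [ x ]) u))
        (behind (pre ++ y ∷ [ x ]) w↭u (subst S (shift pre (y ∷ [ x ]) w) (swap pre x y w s)))
    behind pre (Perm.trans w↭v v↭u)            s = behind pre v↭u (behind pre w↭v s)

  ∈-skip : ∀ (A' O P : List A) {x} → x ∈ A' ++ P → x ∈ A' ++ O ++ P
  ∈-skip A' O P x∈ with ∈-++⁻ A' x∈
  ... | inj₁ x∈A = ∈-++⁺ˡ x∈A
  ... | inj₂ x∈P = ∈-++⁺ʳ A' (∈-++⁺ʳ O x∈P)

  ∈-inserted : ∀ (A' O P : List A) {x} → x ∈ O → x ∈ A' ++ O ++ P
  ∈-inserted A' O P x∈O = ∈-++⁺ʳ A' (∈-++⁺ˡ x∈O)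

  ∈-insert⁻ : ∀ (A' O P : List A) {x} → x ∈ A' ++ O ++ P → x ∈ O ⊎ x ∈ A' ++ P
  ∈-insert⁻ A' O P x∈ with ∈-++⁻ A' x∈
  ... | inj₁ x∈A = inj₂ (∈-++⁺ˡ x∈A)
  ... | inj₂ x∈OP with ∈-++⁻ O x∈OP
  ...   | inj₁ x∈O = inj₁ x∈O
  ...   | inj₂ x∈P = inj₂ (∈-++⁺ʳ A' x∈P)

  unique-insert : ∀ (A' : List A) {O P} → Unique (A' ++ P) → Unique O →
                  (∀ {x} → x ∈ O → x ∉ A' ++ P) → Unique (A' ++ O ++ P)
  unique-insert []       uP uO disjoint = Unique.++⁺ uO uP (λ (x∈O , x∈P) → disjoint x∈O x∈P)
  unique-insert (a ∷ A') {O} {P} (a∉ ∷ uAP) uO disjoint =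
    All.tabulate (λ x∈ → a≢ (∈-insert⁻ A' O P x∈)) ∷
    unique-insert A' uAP uO (λ x∈O x∈ → disjoint x∈O (there x∈))
    where
    a≢ : ∀ {x} → x ∈ O ⊎ x ∈ A' ++ P → a ≢ x
    a≢ (inj₁ x∈O) refl = disjoint x∈O (here refl)
    a≢ (inj₂ x∈)       = All.lookup a∉ x∈

  allWords : List A → ℕ → List (List A)
  allWords alphabet zero    = [] ∷ []
  allWords alphabet (suc m) = cartesianProductWith _∷_ alphabet (allWords alphabet m)

  ∈-allWords : ∀ {alphabet} (w : List A) → All (_∈ alphabet) w → w ∈ allWords alphabet (length w)
  ∈-allWords []      []         = here refl
  ∈-allWords (x ∷ w) (x∈ ∷ w∈) = ∈-cartesianProductWith⁺ _∷_ x∈ (∈-allWords w w∈)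

-- The termination measure of the joining process: how many entries of a fixed
-- list V are still missing from the growing list B.
module Missing {A : Set} (_≟ᴬ_ : DecidableEquality A) where
  open import Data.List.Membership.DecPropositional _≟ᴬ_ using (_∈?_)

  missing : List A → List A → ℕ
  missing B []      = 0
  missing B (u ∷ V) with u ∈? B
  ... | yes _ = missing B V
  ... | no  _ = suc (missing B V)

  missing-antitone : ∀ {B B'} → (∀ {x} → x ∈ B → x ∈ B') → ∀ V → missing B' V ≤ missing B V
  missing-antitone ⊆ [] = z≤n
  missing-antitone {B} {B'} ⊆ (u ∷ V) with u ∈? B' | u ∈? B
  ... | yes _   | yes _  = missing-antitone ⊆ V
  ... | yes _   | no  _  = m≤n⇒m≤1+n (missing-antitone ⊆ V)
  ... | no  u∉ | yes u∈ = ⊥-elim (u∉ (⊆ u∈))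
  ... | no  _   | no  _  = s≤s (missing-antitone ⊆ V)

  missing-decreases : ∀ {B B' q} → (∀ {x} → x ∈ B → x ∈ B') → q ∈ B' → q ∉ B →
                      ∀ V → q ∈ V → missing B' V < missing B V
  missing-decreases {B} {B'} ⊆ q∈B' q∉B (u ∷ V) (here refl) with u ∈? B' | u ∈? B
  ... | _       | yes q∈B = ⊥-elim (q∉B q∈B)
  ... | yes _   | no  _   = s≤s (missing-antitone ⊆ V)
  ... | no  q∉ | no  _   = ⊥-elim (q∉ q∈B')
  missing-decreases {B} {B'} ⊆ q∈B' q∉B (u ∷ V) (there q∈V) with u ∈? B' | u ∈? B
  ... | yes _   | yes _  = missing-decreases ⊆ q∈B' q∉B V q∈V
  ... | yes _   | no  _  = m<n⇒m<1+n (missing-decreases ⊆ q∈B' q∉B V q∈V)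
  ... | no  u∉ | yes u∈ = ⊥-elim (u∉ (⊆ u∈))
  ... | no  _   | no  _  = s≤s (missing-decreases ⊆ q∈B' q∉B V q∈V)

-- If gcd(s,n) = 1 and k + s = n, then k is invertible modulo n: j·k ≡ 1 (mod n)
-- for some j, written without subtraction as j·k + a·n = b·n + 1.
complement-invertible : ∀ {n s k} → 1 ≤ n → k + s ≡ n → Bézout.Identity 1 s n →
                        Σ ℕ λ j → ∃₂ λ a b → j * k + a * n ≡ b * n + 1
complement-invertible {n} {s} {k} _ k+s≡n (Bézout.-+ x y 1+xs≡yn) = x , y , x , (begin
  x * k + y * n       ≡⟨ cong (x * k +_) 1+xs≡yn ⟨
  x * k + (1 + x * s) ≡⟨ rearrange x k s ⟩
  x * (k + s) + 1     ≡⟨ cong (λ t → x * t + 1) k+s≡n ⟩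
  x * n + 1           ∎)
  where
  rearrange : ∀ x k s → x * k + (1 + x * s) ≡ x * (k + s) + 1
  rearrange = solve-∀
complement-invertible {zero}  ()
complement-invertible {suc m} {s} {k} _ k+s≡n (Bézout.+- x y 1+yn≡xs) = x * m , x , x * k + y , (begin
  x * m * k + x * suc m             ≡⟨ cong (λ t → x * m * k + x * t) k+s≡n ⟨
  x * m * k + x * (k + s)           ≡⟨ expand x m k s ⟩
  x * k * suc m + x * s             ≡⟨ cong (x * k * suc m +_) 1+yn≡xs ⟨
  x * k * suc m + (1 + y * suc m)   ≡⟨ collect x m k y ⟩
  (x * k + y) * suc m + 1           ∎)
  where
  expand : ∀ x m k s → x * m * k + x * (k + s) ≡ x * k * (1 + m) + x * s
  expand = solve-∀
  collect : ∀ x m k y → x * k * (1 + m) + (1 + y * (1 + m)) ≡ (x * k + y) * (1 + m) + 1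
  collect = solve-∀

-- Walk u v L: the words of L, in order, lead from the s-letter state u to v;
-- each word starts with the current state, and its letters after the first
-- k = n ∸ s ones (its last s letters) form the next state.
module OverlapWalks (n s : ℕ) where

  k : ℕ
  k = n ∸ s

  data Walk : Word → Word → List Word → Set where
    nil  : ∀ {u} → Walk u u []
    cons : ∀ {u v w ws} → take s w ≡ u → Walk (drop k w) v ws → Walk u v (w ∷ ws)

  walk-++ : ∀ {u m v L M} → Walk u m L → Walk m v M → Walk u v (L ++ M)
  walk-++ nil          q = q
  walk-++ (cons e p)   q = cons e (walk-++ p q)

  walk-split : ∀ {u v} L {M} → Walk u v (L ++ M) → Σ Word λ m → Walk u m L × Walk m v M
  walk-split []      p          = _ , nil , p
  walk-split (w ∷ L) (cons e p) with walk-split L p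
  ... | m , p₁ , p₂ = m , cons e p₁ , p₂

  walk→chain : ∀ {u v y z} ys → Walk u v (y ∷ ys) → take s z ≡ v → Chain (Overlaps n s) (y ∷ ys ++ [ z ])
  walk→chain []       (cons _ nil)        z-at-v = chain-∷ (sym z-at-v) chain-[-]
  walk→chain (y' ∷ ys) (cons _ (cons e p)) z-at-v = chain-∷ (sym e) (walk→chain ys (cons e p) z-at-v)

  closed-walk-is-cyclic : ∀ {v} L → Walk v v L → CyclicChain (Overlaps n s) L
  closed-walk-is-cyclic []      _            = chain-[]
  closed-walk-is-cyclic (w ∷ L) p@(cons e _) = walk→chain L p e

module CycleJoining (n s : ℕ) (s≤n : s ≤ n) (1≤n : 1 ≤ n) where
  open OverlapWalks n s
  open Missing (≡-dec _≟_)
  open import Data.List.Membership.DecPropositional {A = Word} (≡-dec _≟_) using (_∈?_)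

  R : Word → Word
  R = rotL k

  R-overlap : ∀ w → length w ≡ n → take s (R w) ≡ drop k w
  R-overlap w ∣w∣≡n = subst (λ j → take j (R w) ≡ drop k w) ∣drop∣≡s (take-length-++ (drop k w) (take k w))
    where
    ∣drop∣≡s : length (drop k w) ≡ s
    ∣drop∣≡s = trans (length-drop k w) (trans (cong (_∸ k) ∣w∣≡n) (m∸[m∸n]≡n s≤n))

  R-moves-prefix : ∀ A D → length A ≡ k → R (A ++ D) ≡ D ++ A
  R-moves-prefix A D ∣A∣≡k = trans (cong (λ j → rotL j (A ++ D)) (sym ∣A∣≡k)) (rotL-++ A D)

  R-is-ρ-power : ∀ j w → length w ≡ n → iterate R w j ≡ iterate ρ w (j * k)
  R-is-ρ-power zero    w ∣w∣≡n = refl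
  R-is-ρ-power (suc j) w ∣w∣≡n = begin
    iterate R (R w) j                 ≡⟨ R-is-ρ-power j (R w) (trans (length-rotL k w) ∣w∣≡n) ⟩
    iterate ρ (R w) (j * k)           ≡⟨ cong (λ v → iterate ρ v (j * k)) (iterate-ρ k w k≤∣w∣) ⟨
    iterate ρ (iterate ρ w k) (j * k) ≡⟨ iterate-+ ρ w k (j * k) ⟨
    iterate ρ w (k + j * k)           ∎
    where
    k≤∣w∣ : k ≤ length w
    k≤∣w∣ = subst (k ≤_) (sym ∣w∣≡n) (m∸n≤m n s)

  R-period : ∀ w → length w ≡ n → iterate R w n ≡ w
  R-period w ∣w∣≡n = begin
    iterate R w n       ≡⟨ R-is-ρ-power n w ∣w∣≡n ⟩
    iterate ρ w (n * k) ≡⟨ cong (iterate ρ w) (*-comm n k) ⟩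
    iterate ρ w (k * n) ≡⟨ ρ-periodic k w ∣w∣≡n ⟩
    w                   ∎

  R-inverse : ∀ w → length w ≡ n → iterate R (R w) (n ∸ 1) ≡ w
  R-inverse w ∣w∣≡n = trans (cong (iterate R w) (m+[n∸m]≡n 1≤n)) (R-period w ∣w∣≡n)

  coprime⇒ρ-power-of-R : gcd s n ≡ 1 → Σ ℕ λ j → ∀ w → length w ≡ n → iterate R w j ≡ ρ w
  coprime⇒ρ-power-of-R gcd≡1
    with j , a , b , jk≡1 ← complement-invertible 1≤n (m∸n+n≡m s≤n) (coprime-Bézout (gcd≡1⇒coprime gcd≡1))
    = j , λ w ∣w∣≡n → begin
      iterate R w j                           ≡⟨ R-is-ρ-power j w ∣w∣≡n ⟩
      iterate ρ w (j * k)                     ≡⟨ ρ-periodic a (iterate ρ w (j * k)) (ρ-length (j * k) w ∣w∣≡n) ⟨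
      iterate ρ (iterate ρ w (j * k)) (a * n) ≡⟨ iterate-+ ρ w (j * k) (a * n) ⟨
      iterate ρ w (j * k + a * n)             ≡⟨ cong (iterate ρ w) jk≡1 ⟩
      iterate ρ w (b * n + 1)                 ≡⟨ iterate-+ ρ w (b * n) 1 ⟩
      ρ (iterate ρ w (b * n))                 ≡⟨ cong ρ (ρ-periodic b w ∣w∣≡n) ⟩
      ρ w                                     ∎
    where
    ρ-length : ∀ i (w : Word) → length w ≡ n → length (iterate ρ w i) ≡ n
    ρ-length i w =
      iterate-preserves ρ {λ v → length v ≡ n} (λ {v} ∣v∣≡n → trans (length-rotL 1 v) ∣v∣≡n) i

  perm-length : ∀ {w} → IsPermWord n w → length w ≡ n
  perm-length w↭ = trans (↭-length w↭) (trans (length-map suc (upTo n)) (length-upTo n))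

  R-perm : ∀ {w} → IsPermWord n w → IsPermWord n (R w)
  R-perm {w} w↭ = ↭-trans (rotL-↭ k w) w↭

  trajectory-walk : ∀ p u → length u ≡ n → Walk (take s u) (take s (iterate R u p)) (List.iterate R u p)
  trajectory-walk zero    u ∣u∣≡n = nil
  trajectory-walk (suc p) u ∣u∣≡n =
    cons refl (subst (λ v → Walk v (take s (iterate R (R u) p)) (List.iterate R (R u) p))
                     (R-overlap u ∣u∣≡n)
                     (trajectory-walk p (R u) (trans (length-rotL k u) ∣u∣≡n)))

  record Orbit (q : Word) : Set where
    field
      O          : List Word
      O-unique   : Unique O
      O-walk     : Walk (take s q) (take s q) O
      O-∋q       : q ∈ O
      O-R-closed : ∀ {x} → x ∈ O → R x ∈ O
      O-returns  : ∀ {x} → x ∈ O → Σ ℕ λ j → iterate R x j ≡ q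
      O-from-q   : ∀ {x} → x ∈ O → Σ ℕ λ i → x ≡ iterate R q i

  -- the orbit is the trajectory of q up to its exact period, which exists as Rⁿ q = q
  orbit : ∀ q → length q ≡ n → Orbit q
  orbit q ∣q∣≡n
    with p , (0<p , Rᵖq≡q) , minimal ← least (λ i → 0 < i × iterate R q i ≡ q)
                                             (λ i → (0 <? i) ×-dec (≡-dec _≟_ (iterate R q i) q))
                                             n (1≤n , R-period q ∣q∣≡n)
    = record
    { O          = List.iterate R q p
    ; O-unique   = trajectory-unique R (rotL-injective k) q p (λ i 0<i i<p Rⁱq≡q → minimal i i<p (0<i , Rⁱq≡q))
    ; O-walk     = subst (λ v → Walk (take s q) v (List.iterate R q p)) (cong (take s) Rᵖq≡q)
                         (trajectory-walk p q ∣q∣≡n)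
    ; O-∋q       = ∈-trajectory⁺ R q p 0 0<p
    ; O-R-closed = trajectory-closed R q p Rᵖq≡q
    ; O-returns  = trajectory-returns R q p Rᵖq≡q
    ; O-from-q   = λ x∈ → let (i , _ , x≡) = ∈-trajectory⁻ R q p x∈ in i , x≡
    }

  orbit-perm : ∀ {q} (q↭ : IsPermWord n q) {x} → x ∈ Orbit.O (orbit q (perm-length q↭)) → IsPermWord n x
  orbit-perm {q} q↭ x∈ with i , refl ← Orbit.O-from-q (orbit q (perm-length q↭)) x∈ =
    iterate-preserves R {IsPermWord n} R-perm i q↭

  record PartialCycle : Set where
    field
      B           : List Word
      B-perm      : ∀ {w} → w ∈ B → IsPermWord n w
      B-unique    : Unique B
      B-R-closed  : ∀ {w} → w ∈ B → R w ∈ B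
      anchor      : Word
      B-walk      : Walk anchor anchor B
      B-inhabited : Σ Word (_∈ B)

  identity-cycle : PartialCycle
  identity-cycle = record
    { B = O ; B-perm = orbit-perm Perm.refl ; B-unique = O-unique ; B-R-closed = O-R-closed
    ; anchor = take s [1‥ n ] ; B-walk = O-walk ; B-inhabited = [1‥ n ] , O-∋q }
    where open Orbit (orbit [1‥ n ] (perm-length Perm.refl))

  splice : (C : PartialCycle) → ∀ {q} → IsPermWord n q → q ∉ PartialCycle.B C →
           ∀ {p} → p ∈ PartialCycle.B C → take s q ≡ take s p →
           Σ PartialCycle λ C' → (∀ {x} → x ∈ PartialCycle.B C → x ∈ PartialCycle.B C') × q ∈ PartialCycle.B C'
  splice C {q} q↭ q∉B {p} p∈B same-start
    with pre , post , B≡ ← ∈-∃++ p∈B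
    with m , walk-pre , cons p-at-m walk-post ←
           walk-split pre (subst (λ L → Walk _ _ L) B≡ (PartialCycle.B-walk C))
    = C' , (λ x∈B → ∈-skip pre O (p ∷ post) (old x∈B)) , ∈-inserted pre O (p ∷ post) O-∋q
    where
    open PartialCycle C
    open Orbit (orbit q (perm-length q↭))

    old : ∀ {x} → x ∈ B → x ∈ pre ++ p ∷ post
    old {x} = subst (x ∈_) B≡

    old⁻ : ∀ {x} → x ∈ pre ++ p ∷ post → x ∈ B
    old⁻ {x} = subst (x ∈_) (sym B≡)

    -- an orbit element in B would lead back to q inside the R-closed list B
    disjoint : ∀ {x} → x ∈ O → x ∉ pre ++ p ∷ post
    disjoint x∈O x∈B with j , Rʲx≡q ← O-returns x∈O =
      q∉B (subst (_∈ B) Rʲx≡q (iterate-preserves R {_∈ B} B-R-closed j (old⁻ x∈B)))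

    orbit-walk : Walk m m O
    orbit-walk = subst (λ v → Walk v v O) (trans same-start p-at-m) O-walk

    perm : ∀ {x} → x ∈ O ⊎ x ∈ pre ++ p ∷ post → IsPermWord n x
    perm (inj₁ x∈O) = orbit-perm q↭ x∈O
    perm (inj₂ x∈B) = B-perm (old⁻ x∈B)

    R-closed : ∀ {x} → x ∈ O ⊎ x ∈ pre ++ p ∷ post → R x ∈ pre ++ O ++ p ∷ post
    R-closed (inj₁ x∈O) = ∈-inserted pre O (p ∷ post) (O-R-closed x∈O)
    R-closed (inj₂ x∈B) = ∈-skip pre O (p ∷ post) (old (B-R-closed (old⁻ x∈B)))

    C' : PartialCycle
    C' = record
      { B           = pre ++ O ++ p ∷ post
      ; B-perm      = perm ∘ ∈-insert⁻ pre O (p ∷ post)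
      ; B-unique    = unique-insert pre (subst Unique B≡ B-unique) O-unique disjoint
      ; B-R-closed  = R-closed ∘ ∈-insert⁻ pre O (p ∷ post)
      ; anchor      = anchor
      ; B-walk      = walk-++ walk-pre (walk-++ orbit-walk (cons p-at-m walk-post))
      ; B-inhabited = q , ∈-inserted pre O (p ∷ post) O-∋q
      }

  -- every permutation is a word of length n over [n]
  U : List Word
  U = allWords [1‥ n ] n

  perm∈U : ∀ {w} → IsPermWord n w → w ∈ U
  perm∈U {w} w↭ = subst (λ l → w ∈ allWords [1‥ n ] l) (perm-length w↭)
                    (∈-allWords w (All.tabulate (∈-resp-↭ w↭)))

  Escapes : PartialCycle → Word → ℕ → Set
  Escapes C p i = s ≤ i × suc i < n × swapAt i p ∉ PartialCycle.B C

  escapes? : ∀ C p i → Dec (Escapes C p i)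
  escapes? C p i = (s ≤? i) ×-dec (suc i <? n) ×-dec ¬? (swapAt i p ∈? PartialCycle.B C)

  Saturated : PartialCycle → Set
  Saturated C = ∀ {p} → p ∈ PartialCycle.B C → ∀ i → s ≤ i → suc i < n → swapAt i p ∈ PartialCycle.B C

  -- a tail swap keeps the first s letters, so an escaping one can be spliced in,
  -- strictly decreasing the number of missing words; otherwise B is saturated
  extend-or-saturated : (C : PartialCycle) →
    (Σ PartialCycle λ C' → missing (PartialCycle.B C') U < missing (PartialCycle.B C) U) ⊎ Saturated C
  extend-or-saturated C with Any.any? (λ p → Any.any? (escapes? C p) (upTo n)) (PartialCycle.B C)
  ... | yes escape
    with p , p∈B , escape-at-p ← find escape
    with i , _ , (s≤i , _ , p'∉B) ← find escape-at-p
    with C' , B⊆B' , p'∈B' ← splice C (↭-trans (swapAt-↭ i p) (PartialCycle.B-perm C p∈B)) p'∉B p∈B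
                                      (swapAt-take s i p s≤i)
    = inj₁ (C' , missing-decreases B⊆B' p'∈B' p'∉B U (perm∈U (PartialCycle.B-perm C' p'∈B')))
  ... | no no-escape = inj₂ saturated
    where
    saturated : Saturated C
    saturated {p} p∈B i s≤i 1+i<n with swapAt i p ∈? PartialCycle.B C
    ... | yes p'∈B = p'∈B
    ... | no  p'∉B =
      ⊥-elim (no-escape (lose p∈B (lose (∈-upTo⁺ (<-trans (n<1+n i) 1+i<n)) (s≤i , 1+i<n , p'∉B))))

  saturate : ∀ bound (C : PartialCycle) → missing (PartialCycle.B C) U ≤ bound → Σ PartialCycle Saturated
  saturate bound C ≤bound with extend-or-saturated C
  ... | inj₂ sat = C , sat
  saturate zero        C ≤0     | inj₁ (C' , fewer) = ⊥-elim (n≮0 (<-≤-trans fewer ≤0))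
  saturate (suc bound) C ≤bound | inj₁ (C' , fewer) = saturate bound C' (s≤s⁻¹ (<-≤-trans fewer ≤bound))

  SwapClosed : List Word → Set
  SwapClosed B = ∀ xs x y ys → xs ++ x ∷ y ∷ ys ∈ B → xs ++ y ∷ x ∷ ys ∈ B

  module Saturation (C : PartialCycle) (saturated : Saturated C) where
    open PartialCycle C

    ∈B-length : ∀ {w} → w ∈ B → length w ≡ n
    ∈B-length w∈B = perm-length (B-perm w∈B)

    tail-swap : ∀ xs x y ys → xs ++ x ∷ y ∷ ys ∈ B → s ≤ length xs → xs ++ y ∷ x ∷ ys ∈ B
    tail-swap xs x y ys w∈B s≤∣xs∣ =
      subst (_∈ B) (swapAt-middle xs x y ys) (saturated w∈B (length xs) s≤∣xs∣ 1+∣xs∣<n)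
      where
      1+∣xs∣<n : suc (length xs) < n
      1+∣xs∣<n = subst (suc (length xs) <_) (trans (sym (length-middle xs x y ys)) (∈B-length w∈B))
                   (s≤s (s≤s (m≤m+n (length xs) (length ys))))

    length-rest : ∀ (A D : Word) → length (A ++ D) ≡ n → length D ≡ s → length A ≡ k
    length-rest A D ∣AD∣≡n ∣D∣≡s = begin
      length A                    ≡⟨ m+n∸n≡m (length A) s ⟨
      length A + s ∸ s            ≡⟨ cong (λ t → length A + t ∸ s) ∣D∣≡s ⟨
      length A + length D ∸ s     ≡⟨ cong (_∸ s) (length-++ A) ⟨
      length (A ++ D) ∸ s         ≡⟨ cong (_∸ s) ∣AD∣≡n ⟩
      k                           ∎

    rotate-suffix : ∀ A D → A ++ D ∈ B → length D ≡ s → D ++ A ∈ B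
    rotate-suffix A D w∈B ∣D∣≡s =
      subst (_∈ B) (R-moves-prefix A D (length-rest A D (∈B-length w∈B) ∣D∣≡s)) (B-R-closed w∈B)

    rotate-suffix⁻ : ∀ A D → D ++ A ∈ B → length D ≡ s → A ++ D ∈ B
    rotate-suffix⁻ A D w∈B ∣D∣≡s =
      subst (_∈ B) (trans (cong (λ v → iterate R v (n ∸ 1)) (sym R[AD]≡DA)) (R-inverse (A ++ D) ∣AD∣≡n))
        (iterate-preserves R {_∈ B} B-R-closed (n ∸ 1) w∈B)
      where
      ∣AD∣≡n : length (A ++ D) ≡ n
      ∣AD∣≡n = trans (↭-length (++-comm A D)) (∈B-length w∈B)
      R[AD]≡DA : R (A ++ D) ≡ D ++ A
      R[AD]≡DA = R-moves-prefix A D (length-rest A D ∣AD∣≡n ∣D∣≡s)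

    -- Case 2s < n: a pair in the first s positions is followed by at least s
    -- letters D; bringing D to the front turns the swap into a tail swap.
    swap-closed-if-short : s + s < n → SwapClosed B
    swap-closed-if-short s+s<n xs x y ys w∈B with s ≤? length xs
    ... | yes s≤∣xs∣ = tail-swap xs x y ys w∈B s≤∣xs∣
    ... | no  s≰∣xs∣ = subst (_∈ B) (cong (λ t → xs ++ y ∷ x ∷ t) Z++D≡ys) swapped
      where
      s≤∣ys∣ : s ≤ length ys
      s≤∣ys∣ with s ≤? length ys
      ... | yes s≤ = s≤
      ... | no  s≰ = ⊥-elim (<⇒≱ s+s<n (subst (_≤ s + s) n≡ (+-mono-≤ (≰⇒> s≰∣xs∣) (≰⇒> s≰))))
        where
        n≡ : suc (length xs) + suc (length ys) ≡ n
        n≡ = trans (cong suc (+-suc (length xs) (length ys)))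
                   (trans (sym (length-middle xs x y ys)) (∈B-length w∈B))

      Z D : Word
      Z = take (length ys ∸ s) ys
      D = drop (length ys ∸ s) ys

      ∣D∣≡s : length D ≡ s
      ∣D∣≡s = trans (length-drop (length ys ∸ s) ys) (m∸[m∸n]≡n s≤∣ys∣)

      Z++D≡ys : Z ++ D ≡ ys
      Z++D≡ys = take++drop≡id (length ys ∸ s) ys

      D-at-end : (xs ++ x ∷ y ∷ Z) ++ D ∈ B
      D-at-end = subst (_∈ B) (sym (++-assoc xs (x ∷ y ∷ Z) D))
                   (subst (λ t → xs ++ x ∷ y ∷ t ∈ B) (sym Z++D≡ys) w∈B)

      D-in-front : (D ++ xs) ++ x ∷ y ∷ Z ∈ B
      D-in-front = subst (_∈ B) (sym (++-assoc D xs (x ∷ y ∷ Z)))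
                     (rotate-suffix (xs ++ x ∷ y ∷ Z) D D-at-end ∣D∣≡s)

      s≤∣D++xs∣ : s ≤ length (D ++ xs)
      s≤∣D++xs∣ = ≤-trans (≤-reflexive (sym ∣D∣≡s)) (length-++-≤ˡ D)

      swapped-in-front : D ++ xs ++ y ∷ x ∷ Z ∈ B
      swapped-in-front = subst (_∈ B) (++-assoc D xs (y ∷ x ∷ Z))
                           (tail-swap (D ++ xs) x y Z D-in-front s≤∣D++xs∣)

      swapped : xs ++ y ∷ x ∷ Z ++ D ∈ B
      swapped = subst (_∈ B) (++-assoc xs (y ∷ x ∷ Z) D)
                  (rotate-suffix⁻ (xs ++ y ∷ x ∷ Z) D swapped-in-front ∣D∣≡s)

    -- Case gcd(s,n) = 1: B is closed under ρ, a power of R, hence under every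
    -- rotation; rotating the pair to the last two positions (which are ≥ s as
    -- s < n ∸ 1) turns the swap into a tail swap.
    swap-closed-if-coprime : gcd s n ≡ 1 → s < n ∸ 1 → SwapClosed B
    swap-closed-if-coprime gcd≡1 s<n-1 xs x y ys w∈B =
      subst (_∈ B) (++-assoc xs (y ∷ x ∷ []) ys) (rotate ys (xs ++ y ∷ x ∷ []) swapped-at-end)
      where
      ρ-closed : ∀ {w} → w ∈ B → ρ w ∈ B
      ρ-closed w∈B with j , Rʲ≡ρ ← coprime⇒ρ-power-of-R gcd≡1 =
        subst (_∈ B) (Rʲ≡ρ _ (∈B-length w∈B)) (iterate-preserves R {_∈ B} B-R-closed j w∈B)

      rotate : ∀ A D → A ++ D ∈ B → D ++ A ∈ B
      rotate A D w∈B = subst (_∈ B) (trans (iterate-ρ (length A) (A ++ D) (length-++-≤ˡ A)) (rotL-++ A D))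
                         (iterate-preserves ρ {_∈ B} ρ-closed (length A) w∈B)

      pair-at-end : (ys ++ xs) ++ x ∷ y ∷ [] ∈ B
      pair-at-end = subst (_∈ B) (sym (++-assoc ys xs (x ∷ y ∷ [])))
                      (rotate (xs ++ x ∷ y ∷ []) ys (subst (_∈ B) (sym (++-assoc xs (x ∷ y ∷ []) ys)) w∈B))

      s≤∣ys++xs∣ : s ≤ length (ys ++ xs)
      s≤∣ys++xs∣ = subst (s ≤_) (+-identityʳ _) (s≤s⁻¹ (subst (λ m → s < m ∸ 1) n≡ s<n-1))
        where
        n≡ : n ≡ suc (suc (length (ys ++ xs) + 0))
        n≡ = trans (sym (∈B-length pair-at-end)) (length-middle (ys ++ xs) x y [])

      swapped-at-end : ys ++ xs ++ y ∷ x ∷ [] ∈ B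
      swapped-at-end = subst (_∈ B) (++-assoc ys xs (y ∷ x ∷ []))
                         (tail-swap (ys ++ xs) x y [] pair-at-end s≤∣ys++xs∣)

    -- B holds some permutation, so closure under adjacent transpositions gives all of them
    all-permutations : SwapClosed B → ∀ {w} → IsPermWord n w → w ∈ B
    all-permutations swap-closed w↭ with w₀ , w₀∈B ← B-inhabited =
      adjacent-swaps-generate (_∈ B) swap-closed (↭-trans (B-perm w₀∈B) (↭-sym w↭)) w₀∈B

  permutation-ocycle : (s + s < n) ⊎ (gcd s n ≡ 1 × s < n ∸ 1) → Σ (List Word) (IsOCycle n s (IsPermWord n))
  permutation-ocycle hyp with C , sat ← saturate _ identity-cycle ≤-refl =
    B , All.tabulate ∈B-length , B-unique , (λ _ → all-permutations swap-closed) , All.tabulate B-perm ,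
    closed-walk-is-cyclic B B-walk
    where
    open PartialCycle C
    open Saturation C sat
    swap-closed : SwapClosed B
    swap-closed = [ swap-closed-if-short , uncurry swap-closed-if-coprime ]′ hyp

mainTheorem2 : (n s : ℕ) → 2 ≤ n → 1 ≤ s →
    ((2 * s < n) ⊎ (gcd s n ≡ 1 × n ≤ 2 * s × s < n ∸ 1)) →
    Σ (List Word) (λ L → IsOCycle n s (IsPermWord n) L)
mainTheorem2 n s 2≤n _ hyp = CycleJoining.permutation-ocycle n s s≤n 1≤n hyp'
  where
  1≤n : 1 ≤ n
  1≤n = ≤-trans (s≤s z≤n) 2≤n

  -- the case n/2 ≤ s only needs gcd(s,n) = 1 and s < n ∸ 1
  hyp' : (s + s < n) ⊎ (gcd s n ≡ 1 × s < n ∸ 1)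
  hyp' = Sum.map (subst (λ t → s + t < n) (+-identityʳ s)) (λ (g , _ , s<n-1) → g , s<n-1) hyp

  s≤n : s ≤ n
  s≤n = [ (λ s+s<n → ≤-trans (m≤m+n s s) (<⇒≤ s+s<n))
        , (λ (_ , s<n-1) → ≤-trans (<⇒≤ s<n-1) (m∸n≤m n 1)) ]′ hyp'
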